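{- Let $i,j,k,l$ be positive integers with $i>k^2-k+1$. Then $\mathcal{G}_{\langle i,j\rangle}\not\subseteq\mathcal{G}_{\langle k,l\rangle}$.
   Context: All digraphs are finite, without loops and without parallel arcs; all graphs are finite and simple. The competition graph of a digraph $D$ has vertex set $V(D)$ and an edge $uv$ ($u\ne v$) iff $u$ and $v$ have a common out-neighbor in $D$. For positive integers $i,j$, an $\langle i,j\rangle$ digraph is a loopless digraph in which every vertex has indegree at most $i$ and outdegree at most $j$. An $\langle i,j\rangle$ competition graph is the competition graph of some $\langle i,j\rangle$ digraph, and $\mathcal{G}_{\langle i,j\rangle}$ denotes the family of all $\langle i,j\rangle$ competition graphs. -}

module Defs where

open import Data.Nat using (ℕ; _≤_)
open import Data.Bool using (Bool; true; false; if_then_else_)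
open import Data.Fin using (Fin)
open import Data.List using (List; map; allFin)
open import Data.Nat.ListAction using (sum)
open import Data.Product using (Σ; ∃; _×_)
open import Relation.Binary.PropositionalEquality using (_≡_; _≢_)
open import Function.Bundles using (_⇔_)

record Digraph (n : ℕ) : Set where
  field
    arc      : Fin n → Fin n → Bool
    loopless : ∀ v → arc v v ≡ false
open Digraph public

record Graph (n : ℕ) : Set where
  field
    adj    : Fin n → Fin n → Bool
    irrefl : ∀ v → adj v v ≡ false
    sym    : ∀ u v → adj u v ≡ adj v u
open Graph public

indicator : Bool → ℕ
indicator b = if b then 1 else 0

outdeg : ∀ {n} → Digraph n → Fin n → ℕ
outdeg D v = sum (map (λ w → indicator (arc D v w)) (allFin _))

indeg : ∀ {n} → Digraph n → Fin n → ℕ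
indeg D v = sum (map (λ u → indicator (arc D u v)) (allFin _))

IsIJDigraph : ℕ → ℕ → ∀ {n} → Digraph n → Set
IsIJDigraph i j D = ∀ v → indeg D v ≤ i × outdeg D v ≤ j

IsCompetitionGraphOf : ∀ {n} → Graph n → Digraph n → Set
IsCompetitionGraphOf {n} G D =
  ∀ u v → (adj G u v ≡ true) ⇔ (u ≢ v × ∃ λ (w : Fin n) → arc D u w ≡ true × arc D v w ≡ true)

InCompFamily : ℕ → ℕ → ∀ {n} → Graph n → Set
InCompFamily i j {n} G = Σ (Digraph n) λ D → IsIJDigraph i j D × IsCompetitionGraphOf G D

-- Let Kᵢ + z be the complete graph Kᵢ together with an isolated vertex z. It is the competition graph
-- of the ⟨i,1⟩ digraph in which every vertex of Kᵢ has a single arc, to z. Conversely, let D be any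
-- digraph with competition graph G and let c(u,v) be the number of common out-neighbours of u and v.
-- Then ∑_{u,v} c(u,v) = ∑_w (indeg w)², ∑_u c(u,u) = ∑_w indeg w and deg u + c(u,u) ≤ ∑_v c(u,v),
-- so ∑_u deg u ≤ ∑_w indeg w (indeg w − 1). For a ⟨k,l⟩ digraph on i + 1 vertices with competition
-- graph Kᵢ + z this reads i (i − 1) ≤ (i + 1)(k² − k), which is impossible once i > k² − k + 1.
module Submission where

open import Defs hiding (sym)
open import Data.Nat using (ℕ; zero; suc; _<_; _≤_; _+_; _*_; _∸_; z≤n; s≤s)
open import Data.Nat.Properties
  using ( ≤-refl; ≤-reflexive; ≤-trans; <-trans; <⇒≱; n<1+n; m≤m+n; m≤n+m; +-comm; +-mono-≤; +-monoˡ-≤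
        ; +-monoʳ-≤; +-monoʳ-<; +-cancelʳ-≤; *-comm; *-suc; *-identityʳ; *-mono-≤; *-monoʳ-≤
        ; ∸-monoˡ-≤; *-distribˡ-∸; +-*-semiring; module ≤-Reasoning)
open import Data.Nat.ListAction as List using ()
open import Data.Nat.Tactic.RingSolver using (solve-∀)
open import Data.Bool using (Bool; true; false; not)
open import Data.Fin using (Fin; zero; suc; _≟_; punchIn)
open import Data.Fin.Properties using (suc-injective; punchInᵢ≢i)
open import Data.List using (map; allFin; tabulate)
open import Data.List.Properties using (map-tabulate)
open import Data.Product using (Σ; _×_; _,_; proj₁; proj₂; ∃)
open import Data.Empty using (⊥-elim)
open import Function using (_∘_; id; _⇔_; mk⇔; Equivalence)
open import Relation.Nullary using (¬_; does; yes; no)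
open import Relation.Nullary.Decidable using (dec-true; dec-false)
open import Relation.Binary.PropositionalEquality
open import Algebra.Properties.Semiring.Sum +-*-semiring
  using (sum-syntax; sum-cong-≗; sum-replicate-zero; sum-remove; ∑-distrib-+; ∑-comm; *-distribˡ-sum; *-distribʳ-sum)

∑-mono-≤ : ∀ {n} {f g : Fin n → ℕ} → (∀ x → f x ≤ g x) → ∑[ x < n ] f x ≤ ∑[ x < n ] g x
∑-mono-≤ {zero}  _   = z≤n
∑-mono-≤ {suc n} f≤g = +-mono-≤ (f≤g zero) (∑-mono-≤ (f≤g ∘ suc))

∑-const : ∀ n c → ∑[ _ < n ] c ≡ n * c
∑-const zero    c = refl
∑-const (suc n) c = cong (c +_) (∑-const n c)

term≤∑ : ∀ {n} (f : Fin n → ℕ) x → f x ≤ ∑[ y < n ] f y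
term≤∑ {suc n} f x = subst (f x ≤_) (sym (sum-remove {i = x} f)) (m≤m+n (f x) _)

∑-mono-≤-except : ∀ {n} {f g : Fin n → ℕ} x → (∀ y → f y ≤ g y) → f x ≡ 0 →
                  ∑[ y < n ] f y + g x ≤ ∑[ y < n ] g y
∑-mono-≤-except {suc n} {f} {g} x f≤g fx≡0 = begin
  ∑[ y < suc n ] f y + g x                   ≡⟨ cong (_+ g x) (sum-remove {i = x} f) ⟩
  (f x + ∑[ j < n ] f (punchIn x j)) + g x   ≡⟨ cong (λ fx → fx + ∑[ j < n ] f (punchIn x j) + g x) fx≡0 ⟩
  ∑[ j < n ] f (punchIn x j) + g x           ≤⟨ +-monoˡ-≤ (g x) (∑-mono-≤ (f≤g ∘ punchIn x)) ⟩
  ∑[ j < n ] g (punchIn x j) + g x           ≡⟨ +-comm _ (g x) ⟩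
  g x + ∑[ j < n ] g (punchIn x j)           ≡⟨ sum-remove {i = x} g ⟨
  ∑[ y < suc n ] g y                         ∎
  where open ≤-Reasoning

listSum-allFin : ∀ n (f : Fin n → ℕ) → List.sum (map f (allFin n)) ≡ ∑[ x < n ] f x
listSum-allFin n f = trans (cong List.sum (map-tabulate id f)) (listSum-tabulate f)
  where
  listSum-tabulate : ∀ {n} (g : Fin n → ℕ) → List.sum (tabulate g) ≡ ∑[ x < n ] g x
  listSum-tabulate {zero}  g = refl
  listSum-tabulate {suc n} g = cong (g zero +_) (listSum-tabulate (g ∘ suc))

module CommonOutNeighbours {n} (D : Digraph n) where

  arc# : Fin n → Fin n → ℕ
  arc# u w = indicator (arc D u w)

  common : Fin n → Fin n → ℕ
  common u v = ∑[ w < n ] (arc# u w * arc# v w)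

  indeg≡∑ : ∀ w → indeg D w ≡ ∑[ u < n ] arc# u w
  indeg≡∑ w = listSum-allFin n (λ u → arc# u w)

  ∑-common-diag≡∑-indeg : ∑[ u < n ] common u u ≡ ∑[ w < n ] indeg D w
  ∑-common-diag≡∑-indeg = begin
    ∑[ u < n ] ∑[ w < n ] (arc# u w * arc# u w)  ≡⟨ sum-cong-≗ (λ u → sum-cong-≗ (λ w → indicator-idem (arc D u w))) ⟩
    ∑[ u < n ] ∑[ w < n ] arc# u w               ≡⟨ ∑-comm arc# ⟩
    ∑[ w < n ] ∑[ u < n ] arc# u w               ≡⟨ sum-cong-≗ indeg≡∑ ⟨
    ∑[ w < n ] indeg D w                         ∎
    where
    open ≡-Reasoning
    indicator-idem : ∀ b → indicator b * indicator b ≡ indicator b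
    indicator-idem true  = refl
    indicator-idem false = refl

  ∑-common≡∑-indeg² : ∑[ u < n ] ∑[ v < n ] common u v ≡ ∑[ w < n ] (indeg D w * indeg D w)
  ∑-common≡∑-indeg² = begin
    ∑[ u < n ] ∑[ v < n ] ∑[ w < n ] (arc# u w * arc# v w)  ≡⟨ sum-cong-≗ (λ u → ∑-comm (λ v w → arc# u w * arc# v w)) ⟩
    ∑[ u < n ] ∑[ w < n ] ∑[ v < n ] (arc# u w * arc# v w)  ≡⟨ ∑-comm (λ u w → ∑[ v < n ] (arc# u w * arc# v w)) ⟩
    ∑[ w < n ] ∑[ u < n ] ∑[ v < n ] (arc# u w * arc# v w)  ≡⟨ sum-cong-≗ (λ w → sum-cong-≗ (λ u → *-distribˡ-sum (arc# u w) (λ v → arc# v w))) ⟨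
    ∑[ w < n ] ∑[ u < n ] (arc# u w * ∑[ v < n ] arc# v w)  ≡⟨ sum-cong-≗ (λ w → *-distribʳ-sum _ (λ u → arc# u w)) ⟨
    ∑[ w < n ] ((∑[ v < n ] arc# v w) * ∑[ u < n ] arc# u w) ≡⟨ sum-cong-≗ (λ w → cong₂ _*_ (indeg≡∑ w) (indeg≡∑ w)) ⟨
    ∑[ w < n ] (indeg D w * indeg D w)                      ∎
    where open ≡-Reasoning

square≤ : ∀ {x k} → x ≤ k → x * x ≤ x + (k * k ∸ k)
square≤ {x} {k} x≤k = begin
  x * x                ≡⟨ square-split x ⟩
  x + x * (x ∸ 1)      ≤⟨ +-monoʳ-≤ x (*-mono-≤ x≤k (∸-monoˡ-≤ 1 x≤k)) ⟩
  x + k * (k ∸ 1)      ≡⟨ cong (x +_) (trans (*-distribˡ-∸ k k 1) (cong (k * k ∸_) (*-identityʳ k))) ⟩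
  x + (k * k ∸ k)      ∎
  where
  open ≤-Reasoning
  square-split : ∀ x → x * x ≡ x + x * (x ∸ 1)
  square-split zero    = refl
  square-split (suc y) = cong (suc y +_) (*-comm y (suc y))

degree : ∀ {n} → Graph n → Fin n → ℕ
degree {n} G u = ∑[ v < n ] indicator (adj G u v)

module _ {n} {G : Graph n} {D : Digraph n} (competition : IsCompetitionGraphOf G D) where
  open CommonOutNeighbours D

  adj≤common : ∀ u v → indicator (adj G u v) ≤ common u v
  adj≤common u v with adj G u v in uv
  ... | false = z≤n
  ... | true with Equivalence.to (competition u v) uv
  ...   | _ , w , uw , vw =
    subst (_≤ common u v) (cong₂ (λ a b → indicator a * indicator b) uw vw)
          (term≤∑ (λ w → arc# u w * arc# v w) w)

  ∑-degree≤ : ∀ {k} → (∀ w → indeg D w ≤ k) → ∑[ u < n ] degree G u ≤ n * (k * k ∸ k)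
  ∑-degree≤ {k} indeg≤k = +-cancelʳ-≤ (∑[ w < n ] indeg D w) _ _ (begin
    ∑[ u < n ] degree G u + ∑[ w < n ] indeg D w     ≡⟨ cong (∑[ u < n ] degree G u +_) ∑-common-diag≡∑-indeg ⟨
    ∑[ u < n ] degree G u + ∑[ u < n ] common u u    ≡⟨ ∑-distrib-+ (degree G) (λ u → common u u) ⟨
    ∑[ u < n ] (degree G u + common u u)             ≤⟨ ∑-mono-≤ row ⟩
    ∑[ u < n ] ∑[ v < n ] common u v                 ≡⟨ ∑-common≡∑-indeg² ⟩
    ∑[ w < n ] (indeg D w * indeg D w)               ≤⟨ ∑-mono-≤ (square≤ ∘ indeg≤k) ⟩
    ∑[ w < n ] (indeg D w + (k * k ∸ k))             ≡⟨ ∑-distrib-+ (indeg D) (λ _ → k * k ∸ k) ⟩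
    ∑[ w < n ] indeg D w + ∑[ _ < n ] (k * k ∸ k)    ≡⟨ +-comm (∑[ w < n ] indeg D w) _ ⟩
    ∑[ _ < n ] (k * k ∸ k) + ∑[ w < n ] indeg D w    ≡⟨ cong (_+ ∑[ w < n ] indeg D w) (∑-const n (k * k ∸ k)) ⟩
    n * (k * k ∸ k) + ∑[ w < n ] indeg D w           ∎)
    where
    open ≤-Reasoning
    row : ∀ u → degree G u + common u u ≤ ∑[ v < n ] common u v
    row u = ∑-mono-≤-except u (adj≤common u) (cong indicator (irrefl G u))

distinct : ∀ {n} → Fin n → Fin n → Bool
distinct x y = not (does (x ≟ y))

distinct-irrefl : ∀ {n} (x : Fin n) → distinct x x ≡ false
distinct-irrefl x = cong not (dec-true (x ≟ x) refl)

distinct-sym : ∀ {n} (x y : Fin n) → distinct x y ≡ distinct y x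
distinct-sym x y with x ≟ y
... | yes refl = sym (distinct-irrefl x)
... | no x≢y   = cong not (sym (dec-false (y ≟ x) (x≢y ∘ sym)))

distinct⇔≢ : ∀ {n} (x y : Fin n) → distinct x y ≡ true ⇔ x ≢ y
distinct⇔≢ x y with x ≟ y
... | yes x≡y = mk⇔ (λ ()) (λ x≢y → ⊥-elim (x≢y x≡y))
... | no x≢y  = mk⇔ (λ _ → x≢y) (λ _ → refl)

1+count-distinct : ∀ {n} (x : Fin n) → 1 + ∑[ y < n ] indicator (distinct x y) ≡ n
1+count-distinct {suc n} x = begin
  1 + ∑[ y < suc n ] distinct# y                         ≡⟨ cong (1 +_) (sum-remove {i = x} distinct#) ⟩
  1 + (distinct# x + ∑[ j < n ] distinct# (punchIn x j)) ≡⟨ cong (λ b → 1 + (indicator b + others)) (distinct-irrefl x) ⟩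
  1 + ∑[ j < n ] distinct# (punchIn x j)                 ≡⟨ cong (1 +_) (sum-cong-≗ distinct-punchIn) ⟩
  1 + ∑[ _ < n ] 1                                       ≡⟨ cong (1 +_) (trans (∑-const n 1) (*-identityʳ n)) ⟩
  suc n                                                  ∎
  where
  open ≡-Reasoning
  distinct# : Fin (suc n) → ℕ
  distinct# y = indicator (distinct x y)
  others : ℕ
  others = ∑[ j < n ] distinct# (punchIn x j)
  distinct-punchIn : ∀ j → distinct# (punchIn x j) ≡ 1
  distinct-punchIn j = cong indicator (Equivalence.from (distinct⇔≢ x _) (punchInᵢ≢i x j ∘ sym))

cliqueAdj : ∀ {i} → Fin (suc i) → Fin (suc i) → Bool
cliqueAdj (suc x) (suc y) = distinct x y
cliqueAdj _       _       = false

clique+point : ∀ i → Graph (suc i)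
clique+point i = record { adj = cliqueAdj ; irrefl = irrefl′ ; sym = sym′ }
  where
  irrefl′ : ∀ u → cliqueAdj u u ≡ false
  irrefl′ zero    = refl
  irrefl′ (suc x) = distinct-irrefl x
  sym′ : ∀ u v → cliqueAdj u v ≡ cliqueAdj v u
  sym′ zero    zero    = refl
  sym′ zero    (suc _) = refl
  sym′ (suc _) zero    = refl
  sym′ (suc x) (suc y) = distinct-sym x y

clique+point-∑-degree : ∀ i → i * i ≤ i + ∑[ u < suc i ] degree (clique+point i) u
clique+point-∑-degree i = begin
  i * i                                                 ≡⟨ ∑-const i i ⟨
  ∑[ x < i ] i                                          ≡⟨ sum-cong-≗ (λ x → sym (1+count-distinct {i} x)) ⟩
  ∑[ x < i ] (1 + degree (clique+point i) (suc x))      ≡⟨ ∑-distrib-+ (λ _ → 1) (degree (clique+point i) ∘ suc) ⟩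
  ∑[ _ < i ] 1 + ∑[ x < i ] degree (clique+point i) (suc x)
                                                        ≡⟨ cong (_+ ∑[ x < i ] degree (clique+point i) (suc x))
                                                                (trans (∑-const i 1) (*-identityʳ i)) ⟩
  i + ∑[ x < i ] degree (clique+point i) (suc x)        ≤⟨ +-monoʳ-≤ i (m≤n+m _ _) ⟩
  i + ∑[ u < suc i ] degree (clique+point i) u          ∎
  where open ≤-Reasoning

arcToZero : ∀ {i} → Fin (suc i) → Fin (suc i) → Bool
arcToZero (suc _) zero = true
arcToZero _       _    = false

inStar : ∀ i → Digraph (suc i)
inStar i = record { arc = arcToZero ; loopless = λ { zero → refl ; (suc _) → refl } }

inStar-⟨i,1⟩ : ∀ i → IsIJDigraph i 1 (inStar i)
inStar-⟨i,1⟩ i v = indeg≤i v , outdeg≤1 v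
  where
  indeg≤i : ∀ v → indeg (inStar i) v ≤ i
  indeg≤i v rewrite listSum-allFin (suc i) (λ u → indicator (arcToZero u v)) with v
  ... | zero  = ≤-reflexive (trans (∑-const i 1) (*-identityʳ i))
  ... | suc _ = ≤-trans (≤-reflexive (sum-replicate-zero i)) z≤n
  outdeg≤1 : ∀ v → outdeg (inStar i) v ≤ 1
  outdeg≤1 v rewrite listSum-allFin (suc i) (λ w → indicator (arcToZero v w)) with v
  ... | zero  = ≤-trans (≤-reflexive (sum-replicate-zero i)) z≤n
  ... | suc _ = s≤s (≤-reflexive (sum-replicate-zero i))

inStar-competition : ∀ i → IsCompetitionGraphOf (clique+point i) (inStar i)
inStar-competition i u v = mk⇔ (to u v) (from u v)
  where
  CommonOutNeighbour : Fin (suc i) → Fin (suc i) → Set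
  CommonOutNeighbour u v = ∃ λ w → arcToZero u w ≡ true × arcToZero v w ≡ true
  to : ∀ u v → cliqueAdj u v ≡ true → u ≢ v × CommonOutNeighbour u v
  to (suc x) (suc y) xy = Equivalence.to (distinct⇔≢ x y) xy ∘ suc-injective , zero , refl , refl
  from : ∀ u v → u ≢ v × CommonOutNeighbour u v → cliqueAdj u v ≡ true
  from (suc x) (suc y) (u≢v , _)         = Equivalence.from (distinct⇔≢ x y) (u≢v ∘ cong suc)
  from zero    _       (_ , zero  , () , _)
  from zero    _       (_ , suc _ , () , _)
  from (suc _) zero    (_ , zero  , _ , ())
  from (suc _) zero    (_ , suc _ , _ , ())

IsIJDigraph-mono : ∀ {i i′ j j′ n} {D : Digraph n} → i ≤ i′ → j ≤ j′ → IsIJDigraph i j D → IsIJDigraph i′ j′ D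
IsIJDigraph-mono i≤i′ j≤j′ ⟨i,j⟩ v = ≤-trans (proj₁ (⟨i,j⟩ v)) i≤i′ , ≤-trans (proj₂ (⟨i,j⟩ v)) j≤j′

square-exceeds : ∀ {i m} → m + 1 < i → i + suc i * m < i * i
square-exceeds {i} {m} m+1<i = begin-strict
  i + suc i * m        ≡⟨ regroup i m ⟩
  i * suc m + m        <⟨ +-monoʳ-< (i * suc m) (<-trans (n<1+n m) m+1<i′) ⟩
  i * suc m + i        ≡⟨ +-comm (i * suc m) i ⟩
  i + i * suc m        ≡⟨ *-suc i (suc m) ⟨
  i * suc (suc m)      ≤⟨ *-monoʳ-≤ i m+1<i′ ⟩
  i * i                ∎
  where
  open ≤-Reasoning
  m+1<i′ : suc m < i
  m+1<i′ = subst (_< i) (+-comm m 1) m+1<i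
  regroup : ∀ i m → i + suc i * m ≡ i * suc m + m
  regroup = solve-∀

proposition3p5 : (i j k l : ℕ) → 0 < i → 0 < j → 0 < k → 0 < l →
    k * k ∸ k + 1 < i →
    Σ ℕ λ n → Σ (Graph n) λ G → InCompFamily i j G × ¬ InCompFamily k l G
proposition3p5 i j k l _ 0<j _ _ m+1<i =
  suc i , clique+point i ,
  (inStar i , IsIJDigraph-mono {D = inStar i} ≤-refl 0<j (inStar-⟨i,1⟩ i) , inStar-competition i) ,
  λ (D , ⟨k,l⟩ , competition) → <⇒≱ (square-exceeds m+1<i) (begin
    i * i                                      ≤⟨ clique+point-∑-degree i ⟩
    i + ∑[ u < suc i ] degree (clique+point i) u ≤⟨ +-monoʳ-≤ i (∑-degree≤ {G = clique+point i} {D = D} competition (proj₁ ∘ ⟨k,l⟩)) ⟩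
    i + suc i * (k * k ∸ k)                    ∎)
  where open ≤-Reasoning
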